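{- Let $m\ge 0$ and $n\geq 1$. The subposet of $\mathbf{W}(m,n)$ induced on its join-irreducible elements is isomorphic to the disjoint union $(\mathbf{m}\times\mathbf{n})\uplus\mathbf{1}\uplus\cdots\uplus\mathbf{1}$ with $n-1$ copies of $\mathbf{1}$, where $\mathbf{k}$ denotes a $k$-element chain, $\times$ the direct (componentwise) product and $\uplus$ disjoint union of posets (elements of different summands incomparable).
   Context: An $(m,n)$-word is a word $\mathfrak{w}=w_1w_2\cdots w_n$ of length $n$ over the alphabet $\{0,1,\dots,m+1\}$ such that (MN1) $w_1\neq m+1$, and (MN2) for every $s$ with $1\le s\le m$ and every index $i$, if $w_i=s$ then $w_j\ge s$ for all $j<i$. $\mathbf{W}(m,n)$ is the set of $(m,n)$-words ordered componentwise; it is a lattice. An element $j$ of a finite lattice is join-irreducible if $j=p\vee q$ implies $p=j$ or $q=j$ (the bottom element is not join-irreducible). The $0$-chain $\mathbf{0}$ is empty. -}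

module Defs where

open import Data.Nat using (ℕ; zero; suc; _≤_; _<_; _∸_)
open import Data.Fin using (Fin; toℕ)
open import Data.Vec using (Vec; lookup)
open import Data.Product using (_×_; ∃)
open import Data.Sum using (_⊎_; inj₁; inj₂)
open import Data.Empty using (⊥)
open import Relation.Nullary using (¬_)
open import Relation.Binary.PropositionalEquality using (_≡_)
import Data.Fin as F

Letters : ℕ → Set
Letters m = Fin (suc (suc m))

RawWord : ℕ → ℕ → Set
RawWord m n = Vec (Letters m) n

-- (MN1): w_1 ≠ m+1 (positions are 0-indexed here: position 0 is w_1).
MN1 : ∀ {m n} → RawWord m n → Set
MN1 {m} {n} w = (i : Fin n) → toℕ i ≡ 0 → ¬ (toℕ (lookup w i) ≡ suc m)

MN2 : ∀ {m n} → RawWord m n → Set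
MN2 {m} {n} w = (i j : Fin n) (s : ℕ) → 1 ≤ s → s ≤ m →
  toℕ (lookup w i) ≡ s → toℕ j < toℕ i → s ≤ toℕ (lookup w j)

IsWord : ∀ {m n} → RawWord m n → Set
IsWord w = MN1 w × MN2 w

_≤W_ : ∀ {m n} → RawWord m n → RawWord m n → Set
_≤W_ {m} {n} u v = (i : Fin n) → toℕ (lookup u i) ≤ toℕ (lookup v i)

IsJoin : ∀ {m n} → RawWord m n → RawWord m n → RawWord m n → Set
IsJoin {m} {n} p q j = p ≤W j × q ≤W j ×
  ((u : RawWord m n) → IsWord u → p ≤W u → q ≤W u → j ≤W u)

IsBottom : ∀ {m n} → RawWord m n → Set
IsBottom {m} {n} j = (u : RawWord m n) → IsWord u → j ≤W u

JoinIrreducible : ∀ {m n} → RawWord m n → Set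
JoinIrreducible {m} {n} j = IsWord j × ¬ IsBottom j ×
  ((p q : RawWord m n) → IsWord p → IsWord q → IsJoin p q j → (p ≡ j) ⊎ (q ≡ j))

-- The poset (m × n) ⊎ 1 ⊎ ... ⊎ 1 (n-1 copies of the one-element chain 1).
-- Carrier: (Fin m × Fin n) ⊎ Fin (n ∸ 1); the i-th copy of 1 is inj₂ i.
Target : ℕ → ℕ → Set
Target m n = (Fin m × Fin n) ⊎ Fin (n ∸ 1)

data _≤T_ {m n : ℕ} : Target m n → Target m n → Set where
  prod : ∀ {a b c d} → a F.≤ c → b F.≤ d → inj₁ (a Data.Product., b) ≤T inj₁ (c Data.Product., d)
  one  : ∀ {i} → inj₂ i ≤T inj₂ i

-- Order isomorphism between Target m n and the subposet of join-irreducibles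
-- of W(m,n), presented as a map f : Target → RawWord that is an order
-- embedding whose image is exactly the set of join-irreducibles.
IsoToJI : (m n : ℕ) → (Target m n → RawWord m n) → Set
IsoToJI m n f =
  ((x : Target m n) → JoinIrreducible (f x)) ×
  ((w : RawWord m n) → JoinIrreducible w → ∃ λ x → f x ≡ w) ×
  ((x y : Target m n) → (x ≤T y → f x ≤W f y) × (f x ≤W f y → x ≤T y))

-- Words are closed under the letterwise maximum, so joins in W(m,n) are
-- letterwise maxima. Hence a word that is the least word carrying its own
-- letter at some position g is join-irreducible: in w = p ∨ q the letter of w
-- at g is the letter of p or of q there. The words (a+1)^(b+1) 0^(n-b-1)
-- (least with letter a+1 ≤ m at b) and 0^(k+1) (m+1) 0^(n-k-2) (least with
-- letter m+1 at k+1) are of this kind, and they are ordered like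
-- (𝐦 × 𝐧) ⊎ 𝟏 ⊎ ⋯ ⊎ 𝟏. Conversely, if w is join-irreducible and its last
-- nonzero letter c sits at position i, then w is the join of the least word
-- with letter c at i and of w with that letter replaced by 0; the latter is
-- not w, so w is one of the words above.
module Submission where

open import Defs
open import Data.Nat using (ℕ; _≤_)
open import Data.Product using (Σ)

open import Data.Nat using (suc; _<_; _∸_; _⊔_; z≤n; s≤s)
open import Data.Nat.Properties
open import Data.Fin as F using (Fin; toℕ; fromℕ; fromℕ<; inject₁)
open import Data.Fin.Properties
  using (toℕ-injective; toℕ<n; toℕ-fromℕ; toℕ-fromℕ<; toℕ-inject₁; any?)
  renaming (<-cmp to Fin-<-cmp; suc-injective to Fin-suc-injective)
open import Data.Vec using (lookup; tabulate; replicate; zipWith; _[_]≔_)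
open import Data.Vec.Properties
  using (lookup∘tabulate; lookup-replicate; lookup-zipWith; lookup∘update; lookup∘update′)
open import Data.Vec.Relation.Binary.Pointwise.Extensional using (ext; Pointwise-≡⇒≡)
open import Data.Product using (_×_; _,_; proj₁; ∃)
open import Data.Sum as Sum using (_⊎_; inj₁; inj₂; [_,_])
open import Data.Empty using (⊥-elim)
open import Function using (id; _∘_)
open import Relation.Binary using (tri<; tri≈; tri>)
open import Relation.Nullary using (¬_; yes; no; contradiction)
open import Relation.Unary using (Pred; Decidable)
open import Relation.Binary.PropositionalEquality
  using (_≡_; _≢_; refl; sym; trans; cong; subst; subst₂; module ≡-Reasoning)

private
  variable
    m n : ℕ

val : RawWord m n → Fin n → ℕ
val w i = toℕ (lookup w i)

val≤1+m : (w : RawWord m n) (i : Fin n) → val w i ≤ suc m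
val≤1+m w i = ≤-pred (toℕ<n (lookup w i))

≤W-antisym : {u v : RawWord m n} → u ≤W v → v ≤W u → u ≡ v
≤W-antisym u≤v v≤u =
  Pointwise-≡⇒≡ (ext λ i → toℕ-injective (≤-antisym (u≤v i) (v≤u i)))

lastSatisfying : ∀ {p} {P : Pred (Fin n) p} → Decidable P → ∃ P →
                 ∃ λ k → P k × (∀ j → k F.< j → ¬ P j)
lastSatisfying {suc n} P? (i , Pi) with any? (P? ∘ F.suc)
... | yes found with lastSatisfying (P? ∘ F.suc) found
...   | k , Pk , after =
  F.suc k , Pk , λ { F.zero () ; (F.suc j) k<j → after j (≤-pred k<j) }
lastSatisfying {suc n} {P = P} P? (i , Pi) | no none =
  F.zero , zeroSatisfies i Pi , λ { F.zero () ; (F.suc j) _ Psj → none (j , Psj) }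
  where
  zeroSatisfies : ∀ i → P i → P F.zero
  zeroSatisfies F.zero    P0  = P0
  zeroSatisfies (F.suc i) Psi = contradiction (i , Psi) none

positive-letter : ∀ {v} → 0 < v → v < suc m → ∃ λ (a : Fin m) → v ≡ suc (toℕ a)
positive-letter {v = suc v} _ (s≤s v<m) = fromℕ< v<m , cong suc (sym (toℕ-fromℕ< v<m))

zeroWord : RawWord m n
zeroWord {n = n} = replicate n F.zero

val-zeroWord : (i : Fin n) → val (zeroWord {m}) i ≡ 0
val-zeroWord i = cong toℕ (lookup-replicate i F.zero)

zeroWord-isWord : IsWord (zeroWord {m} {n})
zeroWord-isWord =
    (λ i _ wᵢ≡1+m → 0≢1+n (trans (sym (val-zeroWord i)) wᵢ≡1+m))
  , (λ i _ s 1≤s _ wᵢ≡s _ →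
       ⊥-elim (n>0⇒n≢0 1≤s (trans (sym wᵢ≡s) (val-zeroWord i))))

positive⇒¬IsBottom : (w : RawWord m n) (i : Fin n) → 0 < val w i → ¬ IsBottom w
positive⇒¬IsBottom w i 0<wᵢ bottom =
  <⇒≱ 0<wᵢ (subst (val w i ≤_) (val-zeroWord i) (bottom zeroWord zeroWord-isWord i))

¬IsBottom⇒positive : (w : RawWord m n) → ¬ IsBottom w → ∃ λ i → 0 < val w i
¬IsBottom⇒positive w ¬bottom with any? (λ i → 0 <? val w i)
... | yes found = found
... | no none =
  ⊥-elim (¬bottom λ u _ i → ≤-trans (≮⇒≥ (λ 0<wᵢ → none (i , 0<wᵢ))) z≤n)

_⊔ᴸ_ : Letters m → Letters m → Letters m
a ⊔ᴸ b = fromℕ< (⊔-pres-<m (toℕ<n a) (toℕ<n b))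

_⊔W_ : RawWord m n → RawWord m n → RawWord m n
_⊔W_ = zipWith _⊔ᴸ_

val-⊔W : (p q : RawWord m n) (i : Fin n) → val (p ⊔W q) i ≡ val p i ⊔ val q i
val-⊔W p q i = trans (cong toℕ (lookup-zipWith _⊔ᴸ_ i p q)) (toℕ-fromℕ< _)

⊔W-upperˡ : (p q : RawWord m n) → p ≤W (p ⊔W q)
⊔W-upperˡ p q i = subst (val p i ≤_) (sym (val-⊔W p q i)) (m≤m⊔n _ _)

⊔W-upperʳ : (p q : RawWord m n) → q ≤W (p ⊔W q)
⊔W-upperʳ p q i = subst (val q i ≤_) (sym (val-⊔W p q i)) (m≤n⊔m _ _)

⊔W-sel : (p q : RawWord m n) (i : Fin n) →
         val (p ⊔W q) i ≡ val p i ⊎ val (p ⊔W q) i ≡ val q i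
⊔W-sel p q i rewrite val-⊔W p q i = ⊔-sel (val p i) (val q i)

⊔W-isWord : {p q : RawWord m n} → IsWord p → IsWord q → IsWord (p ⊔W q)
⊔W-isWord {p = p} {q} (mn1ᵖ , mn2ᵖ) (mn1ᵠ , mn2ᵠ) = mn1 , mn2
  where
  mn1 : MN1 (p ⊔W q)
  mn1 i i≡0 eq with ⊔W-sel p q i
  ... | inj₁ ≡pᵢ = mn1ᵖ i i≡0 (trans (sym ≡pᵢ) eq)
  ... | inj₂ ≡qᵢ = mn1ᵠ i i≡0 (trans (sym ≡qᵢ) eq)
  mn2 : MN2 (p ⊔W q)
  mn2 i j s 1≤s s≤m eq j<i with ⊔W-sel p q i
  ... | inj₁ ≡pᵢ =
    ≤-trans (mn2ᵖ i j s 1≤s s≤m (trans (sym ≡pᵢ) eq) j<i) (⊔W-upperˡ p q j)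
  ... | inj₂ ≡qᵢ =
    ≤-trans (mn2ᵠ i j s 1≤s s≤m (trans (sym ≡qᵢ) eq) j<i) (⊔W-upperʳ p q j)

IsJoin⇒≤⊔ : {p q w : RawWord m n} → IsWord p → IsWord q → IsJoin p q w →
            ∀ i → val w i ≤ val p i ⊔ val q i
IsJoin⇒≤⊔ {p = p} {q} isWordᵖ isWordᵠ (_ , _ , least) i =
  subst (_ ≤_) (val-⊔W p q i)
        (least (p ⊔W q) (⊔W-isWord {p = p} {q} isWordᵖ isWordᵠ)
               (⊔W-upperˡ p q) (⊔W-upperʳ p q) i)

≤⊔⇒IsJoin : {p q w : RawWord m n} → p ≤W w → q ≤W w →
            (∀ i → val w i ≤ val p i ⊔ val q i) → IsJoin p q w
≤⊔⇒IsJoin p≤w q≤w w≤p⊔q =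
  p≤w , q≤w , λ u _ p≤u q≤u i → ≤-trans (w≤p⊔q i) (⊔-lub (p≤u i) (q≤u i))

LeastAt : RawWord m n → Fin n → Set
LeastAt w g = ∀ p → IsWord p → val p g ≡ val w g → w ≤W p

LeastAt⇒JoinIrreducible : {w : RawWord m n} (g : Fin n) →
                          IsWord w → 0 < val w g → LeastAt w g → JoinIrreducible w
LeastAt⇒JoinIrreducible {w = w} g isWord 0<w₉ least =
  isWord , positive⇒¬IsBottom w g 0<w₉ , irreducible
  where
  reaches : ∀ {p} → IsWord p → p ≤W w → val w g ≤ val p g → p ≡ w
  reaches {p} isWordᵖ p≤w w₉≤p₉ =
    ≤W-antisym p≤w (least p isWordᵖ (≤-antisym (p≤w g) w₉≤p₉))
  irreducible : ∀ p q → IsWord p → IsWord q → IsJoin p q w → p ≡ w ⊎ q ≡ w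
  irreducible p q isWordᵖ isWordᵠ join@(p≤w , q≤w , _) =
    Sum.map (λ ⊔≡p₉ → reaches isWordᵖ p≤w (subst (_ ≤_) ⊔≡p₉ w₉≤p₉⊔q₉))
            (λ ⊔≡q₉ → reaches isWordᵠ q≤w (subst (_ ≤_) ⊔≡q₉ w₉≤p₉⊔q₉))
            (⊔-sel (val p g) (val q g))
    where
    w₉≤p₉⊔q₉ : val w g ≤ val p g ⊔ val q g
    w₉≤p₉⊔q₉ = IsJoin⇒≤⊔ {p = p} {q} {w} isWordᵖ isWordᵠ join g

LastLetterAt : RawWord m n → Fin n → Set
LastLetterAt w i = 0 < val w i × (∀ j → i F.< j → val w j ≡ 0)

lastLetter-exists : (w : RawWord m n) → ¬ IsBottom w → ∃ (LastLetterAt w)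
lastLetter-exists w ¬bottom
  with lastSatisfying (λ i → 0 <? val w i) (¬IsBottom⇒positive w ¬bottom)
... | i , 0<wᵢ , after = i , 0<wᵢ , λ j i<j → n≤0⇒n≡0 (≮⇒≥ (after j i<j))

val-zeroAt : (w : RawWord m n) (i : Fin n) → val (w [ i ]≔ F.zero) i ≡ 0
val-zeroAt w i = cong toℕ (lookup∘update i w F.zero)

val-zeroAt-off : (w : RawWord m n) {i l : Fin n} → l ≢ i →
                 val (w [ i ]≔ F.zero) l ≡ val w l
val-zeroAt-off w l≢i = cong toℕ (lookup∘update′ l≢i w F.zero)

zeroAt-≤W : (w : RawWord m n) (i : Fin n) → (w [ i ]≔ F.zero) ≤W w
zeroAt-≤W w i l with l F.≟ i
... | yes refl = subst (_≤ val w l) (sym (val-zeroAt w l)) z≤n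
... | no l≢i = ≤-reflexive (val-zeroAt-off w l≢i)

zeroAt-isWord : {w : RawWord m n} {i : Fin n} → IsWord w →
                (∀ j → i F.< j → val w j ≡ 0) → IsWord (w [ i ]≔ F.zero)
zeroAt-isWord {w = w} {i} (mn1ʷ , mn2ʷ) zeroAfter = mn1 , mn2
  where
  mn1 : MN1 (w [ i ]≔ F.zero)
  mn1 l l≡0 eq with l F.≟ i
  ... | yes refl = 0≢1+n (trans (sym (val-zeroAt w l)) eq)
  ... | no l≢i = mn1ʷ l l≡0 (trans (sym (val-zeroAt-off w l≢i)) eq)
  mn2 : MN2 (w [ i ]≔ F.zero)
  mn2 l j s 1≤s s≤m eq j<l with l F.≟ i | j F.≟ i
  ... | yes refl | _ = ⊥-elim (n>0⇒n≢0 1≤s (trans (sym eq) (val-zeroAt w l)))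
  ... | no l≢i | yes refl =
    ⊥-elim (n>0⇒n≢0 1≤s (trans (sym eq) (trans (val-zeroAt-off w l≢i) (zeroAfter l j<l))))
  ... | no l≢i | no j≢i =
    subst (s ≤_) (sym (val-zeroAt-off w j≢i))
          (mn2ʷ l j s 1≤s s≤m (trans (sym (val-zeroAt-off w l≢i)) eq) j<l)

JoinIrreducible-agreeAtLast⇒≡ : {w p : RawWord m n} {i : Fin n} →
                                JoinIrreducible w → LastLetterAt w i →
                                IsWord p → p ≤W w → val p i ≡ val w i → p ≡ w
JoinIrreducible-agreeAtLast⇒≡ {w = w} {p} {i} (isWord , _ , irreducible) (0<wᵢ , zeroAfter)
                              isWordᵖ p≤w pᵢ≡wᵢ =
  [ id , ⊥-elim ∘ q≢w ]
    (irreducible p q isWordᵖ (zeroAt-isWord {w = w} {i} isWord zeroAfter)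
                 (≤⊔⇒IsJoin {p = p} {q} {w} p≤w (zeroAt-≤W w i) covered))
  where
  q : RawWord _ _
  q = w [ i ]≔ F.zero
  q≢w : q ≢ w
  q≢w q≡w = n>0⇒n≢0 0<wᵢ (trans (sym (cong (λ u → val u i) q≡w)) (val-zeroAt w i))
  covered : ∀ l → val w l ≤ val p l ⊔ val q l
  covered l with l F.≟ i
  ... | yes refl = ≤-trans (≤-reflexive (sym pᵢ≡wᵢ)) (m≤m⊔n _ _)
  ... | no l≢i = ≤-trans (≤-reflexive (sym (val-zeroAt-off w l≢i))) (m≤n⊔m _ _)

chainLetter : Fin m → Fin n → Fin n → Letters m
chainLetter a b i with toℕ i ≤? toℕ b
... | yes _ = F.suc (inject₁ a)
... | no _ = F.zero

chainWord : Fin m → Fin n → RawWord m n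
chainWord a b = tabulate (chainLetter a b)

val-chainWord-≤ : (a : Fin m) (b i : Fin n) → i F.≤ b →
                  val (chainWord a b) i ≡ suc (toℕ a)
val-chainWord-≤ a b i i≤b
  rewrite lookup∘tabulate (chainLetter a b) i with toℕ i ≤? toℕ b
... | yes _ = cong suc (toℕ-inject₁ a)
... | no i≰b = contradiction i≤b i≰b

val-chainWord-> : (a : Fin m) (b i : Fin n) → b F.< i → val (chainWord a b) i ≡ 0
val-chainWord-> a b i b<i
  rewrite lookup∘tabulate (chainLetter a b) i with toℕ i ≤? toℕ b
... | yes i≤b = contradiction i≤b (<⇒≱ b<i)
... | no _ = refl

val-chainWord-end : (a : Fin m) (b : Fin n) → val (chainWord a b) b ≡ suc (toℕ a)
val-chainWord-end a b = val-chainWord-≤ a b b ≤-refl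

chainWord-bounded : (a : Fin m) (b i : Fin n) → val (chainWord a b) i ≤ suc (toℕ a)
chainWord-bounded a b i with toℕ i ≤? toℕ b
... | yes i≤b = ≤-reflexive (val-chainWord-≤ a b i i≤b)
... | no i≰b = subst (_≤ _) (sym (val-chainWord-> a b i (≰⇒> i≰b))) z≤n

chainWord-support : (a : Fin m) (b i : Fin n) → 0 < val (chainWord a b) i → i F.≤ b
chainWord-support a b i 0<cᵢ with toℕ i ≤? toℕ b
... | yes i≤b = i≤b
... | no i≰b = contradiction (val-chainWord-> a b i (≰⇒> i≰b)) (n>0⇒n≢0 0<cᵢ)

chainWord-isWord : (a : Fin m) (b : Fin n) → IsWord (chainWord a b)
chainWord-isWord a b = mn1 , mn2
  where
  mn1 : MN1 (chainWord a b)
  mn1 i _ cᵢ≡1+m =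
    <⇒≱ (toℕ<n a) (≤-pred (subst (_≤ _) cᵢ≡1+m (chainWord-bounded a b i)))
  mn2 : MN2 (chainWord a b)
  mn2 i j s 1≤s _ cᵢ≡s j<i = ≤-reflexive (begin
      s                          ≡⟨ sym cᵢ≡s ⟩
      val (chainWord a b) i      ≡⟨ val-chainWord-≤ a b i i≤b ⟩
      suc (toℕ a)                ≡⟨ sym (val-chainWord-≤ a b j j≤b) ⟩
      val (chainWord a b) j      ∎)
    where
    open ≡-Reasoning
    i≤b : i F.≤ b
    i≤b = chainWord-support a b i (subst (0 <_) (sym cᵢ≡s) 1≤s)
    j≤b : j F.≤ b
    j≤b = <⇒≤ (<-≤-trans j<i i≤b)

chainWord-LeastAt : (a : Fin m) (b : Fin n) → LeastAt (chainWord a b) b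
chainWord-LeastAt a b w (_ , mn2ʷ) w_b≡c_b i with Fin-<-cmp i b
... | tri< i<b _ _ rewrite val-chainWord-≤ a b i (<⇒≤ i<b) =
  mn2ʷ b i (suc (toℕ a)) (s≤s z≤n) (toℕ<n a) (trans w_b≡c_b (val-chainWord-end a b)) i<b
... | tri≈ _ refl _ = ≤-reflexive (sym w_b≡c_b)
... | tri> _ _ b<i rewrite val-chainWord-> a b i b<i = z≤n

spikeWord : Fin n → RawWord m n
spikeWord {m = m} g = zeroWord [ g ]≔ fromℕ (suc m)

val-spikeWord : (g : Fin n) → val (spikeWord {m = m} g) g ≡ suc m
val-spikeWord g = trans (cong toℕ (lookup∘update g zeroWord _)) (toℕ-fromℕ _)

val-spikeWord-off : {g i : Fin n} → i ≢ g → val (spikeWord {m = m} g) i ≡ 0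
val-spikeWord-off {i = i} i≢g =
  trans (cong toℕ (lookup∘update′ i≢g zeroWord _)) (val-zeroWord i)

spikeWord-isWord : {g : Fin n} → toℕ g ≢ 0 → IsWord (spikeWord {m = m} g)
spikeWord-isWord {m = m} {g = g} g≢0 = mn1 , mn2
  where
  mn1 : MN1 (spikeWord g)
  mn1 i i≡0 sᵢ≡1+m with i F.≟ g
  ... | yes refl = g≢0 i≡0
  ... | no i≢g = 0≢1+n (trans (sym (val-spikeWord-off i≢g)) sᵢ≡1+m)
  mn2 : MN2 (spikeWord g)
  mn2 i j s 1≤s s≤m eq _ with i F.≟ g
  ... | yes refl = ⊥-elim (1+n≰n (subst (_≤ m) (trans (sym eq) (val-spikeWord i)) s≤m))
  ... | no i≢g = ⊥-elim (n>0⇒n≢0 1≤s (trans (sym eq) (val-spikeWord-off i≢g)))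

spikeWord-LeastAt : (g : Fin n) → LeastAt (spikeWord {m = m} g) g
spikeWord-LeastAt g w _ w₉≡s₉ i with i F.≟ g
... | yes refl = ≤-reflexive (sym w₉≡s₉)
... | no i≢g = subst (_≤ _) (sym (val-spikeWord-off i≢g)) z≤n

shift : Fin (n ∸ 1) → Fin n
shift {suc n} k = F.suc k

shift-injective : {k k′ : Fin (n ∸ 1)} → shift {n} k ≡ shift k′ → k ≡ k′
shift-injective {suc n} = Fin-suc-injective

shift-onto : (i : Fin n) → toℕ i ≢ 0 → ∃ λ k → shift k ≡ i
shift-onto {suc n} F.zero    i≢0 = contradiction refl i≢0
shift-onto {suc n} (F.suc i) _   = i , refl

shift≢0 : (k : Fin (n ∸ 1)) → toℕ (shift {n} k) ≢ 0
shift≢0 {suc n} k ()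

embed : Target m n → RawWord m n
embed (inj₁ (a , b)) = chainWord a b
embed (inj₂ k)       = spikeWord (shift k)

generator : Target m n → Fin n
generator (inj₁ (_ , b)) = b
generator (inj₂ k)       = shift k

embed-isWord : (x : Target m n) → IsWord (embed x)
embed-isWord (inj₁ (a , b)) = chainWord-isWord a b
embed-isWord (inj₂ k)       = spikeWord-isWord (shift≢0 k)

embed-LeastAt : (x : Target m n) → LeastAt (embed x) (generator x)
embed-LeastAt (inj₁ (a , b)) = chainWord-LeastAt a b
embed-LeastAt (inj₂ k)       = spikeWord-LeastAt (shift k)

embed-generator-positive : (x : Target m n) → 0 < val (embed x) (generator x)
embed-generator-positive (inj₁ (a , b)) =
  subst (0 <_) (sym (val-chainWord-end a b)) (s≤s z≤n)
embed-generator-positive {n = n} (inj₂ k) =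
  subst (0 <_) (sym (val-spikeWord (shift {n} k))) (s≤s z≤n)

embed-JoinIrreducible : (x : Target m n) → JoinIrreducible (embed x)
embed-JoinIrreducible x =
  LeastAt⇒JoinIrreducible (generator x) (embed-isWord x)
                          (embed-generator-positive x) (embed-LeastAt x)

embed-below : {w : RawWord m n} → IsWord w → (i : Fin n) → 0 < val w i →
              ∃ λ x → embed x ≤W w × val (embed x) i ≡ val w i
embed-below {m = m} {w = w} isWord i 0<wᵢ with val w i ≟ suc m
... | yes wᵢ≡1+m with shift-onto i (λ i≡0 → proj₁ isWord i i≡0 wᵢ≡1+m)
...   | k , refl =
  inj₂ k , spikeWord-LeastAt i w isWord (trans wᵢ≡1+m (sym (val-spikeWord i)))
         , trans (val-spikeWord i) (sym wᵢ≡1+m)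
embed-below {w = w} isWord i 0<wᵢ | no wᵢ≢1+m
  with positive-letter 0<wᵢ (≤∧≢⇒< (val≤1+m w i) wᵢ≢1+m)
... | a , wᵢ≡1+a =
  inj₁ (a , i) , chainWord-LeastAt a i w isWord (trans wᵢ≡1+a (sym (val-chainWord-end a i)))
               , trans (val-chainWord-end a i) (sym wᵢ≡1+a)

JoinIrreducible⇒embed : {w : RawWord m n} → JoinIrreducible w → ∃ λ x → embed x ≡ w
JoinIrreducible⇒embed {w = w} ji@(isWord , ¬bottom , _) =
  let (i , last) = lastLetter-exists w ¬bottom
      (x , x≤w , xᵢ≡wᵢ) = embed-below {w = w} isWord i (proj₁ last)
  in x , JoinIrreducible-agreeAtLast⇒≡ {w = w} {embed x} ji last
                                       (embed-isWord x) x≤w xᵢ≡wᵢ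

embed-mono : (x y : Target m n) → x ≤T y → embed x ≤W embed y
embed-mono (inj₁ (a , b)) (inj₁ (c , d)) (prod a≤c b≤d) i with toℕ i ≤? toℕ b
... | yes i≤b
  rewrite val-chainWord-≤ a b i i≤b | val-chainWord-≤ c d i (≤-trans i≤b b≤d) = s≤s a≤c
... | no i≰b rewrite val-chainWord-> a b i (≰⇒> i≰b) = z≤n
embed-mono (inj₂ k) (inj₂ .k) one i = ≤-refl

embed-reflects : (x y : Target m n) → embed x ≤W embed y → x ≤T y
embed-reflects (inj₁ (a , b)) (inj₁ (c , d)) x≤y =
  prod (≤-pred (≤-trans 1+a≤y_b (chainWord-bounded c d b)))
       (chainWord-support c d b (<-≤-trans (s≤s z≤n) 1+a≤y_b))
  where
  1+a≤y_b : suc (toℕ a) ≤ val (chainWord c d) b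
  1+a≤y_b = subst (_≤ _) (val-chainWord-end a b) (x≤y b)
embed-reflects {m = m} {n = suc n} (inj₁ (a , b)) (inj₂ k) x≤y =
  contradiction (subst₂ _≤_ (val-chainWord-≤ a b F.zero z≤n) s₀≡0 (x≤y F.zero)) λ ()
  where
  s₀≡0 : val (spikeWord {m = m} (F.suc k)) F.zero ≡ 0
  s₀≡0 = val-spikeWord-off {m = m} {g = F.suc k} {i = F.zero} (λ ())
embed-reflects {m = m} {n = n} (inj₂ k) (inj₁ (c , d)) x≤y =
  ⊥-elim (<⇒≱ (toℕ<n c) (≤-pred (≤-trans 1+m≤y_g (chainWord-bounded c d (shift k)))))
  where
  1+m≤y_g : suc m ≤ val (chainWord c d) (shift k)
  1+m≤y_g = subst (_≤ val (chainWord c d) (shift k)) (val-spikeWord (shift {n} k)) (x≤y (shift k))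
embed-reflects {m = m} {n = n} (inj₂ k) (inj₂ k′) x≤y with k F.≟ k′
... | yes refl = one
... | no k≢k′ =
  contradiction (subst₂ _≤_ (val-spikeWord (shift {n} k)) s′ₖ≡0 (x≤y (shift k))) λ ()
  where
  s′ₖ≡0 : val (spikeWord {m = m} (shift {n} k′)) (shift k) ≡ 0
  s′ₖ≡0 = val-spikeWord-off (k≢k′ ∘ shift-injective {n})

lemma5p9 : (m n : ℕ) → 1 ≤ n → Σ (Target m n → RawWord m n) (IsoToJI m n)
lemma5p9 m n _ =
    embed
  , embed-JoinIrreducible
  , (λ _ → JoinIrreducible⇒embed)
  , λ x y → embed-mono x y , embed-reflects x y
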